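{- Let $m\le n$ and let $\sigma<m$. For $m\times n$ arrays with entries from an alphabet $\{0,\dots,\sigma-1\}$ of size $\sigma$, at least $n\log\binom{m-1}{\sigma-1}$ bits, which is $\Omega(n\sigma\log(m/\sigma))$, are necessary to answer 3-sided RMQ.
   Context: For a rectangle $[i_1,i_2]\times[j_1,j_2]$, $\mathsf{rmq}(i_1,i_2,j_1,j_2)$ returns the position of a smallest element in the rectangle, ties broken by returning the top-leftmost such position. A 3-sided RMQ is a query with range $[1,i]\times[j_1,j_2]$ for $i\in[m]$, $1\le j_1\le j_2\le n$. "At least $X$ bits are necessary" means that the number of distinct answer functions (query $\mapsto$ answer) induced by all admissible input arrays is at least $2^X$. -}

module Defs where

open import Data.Nat using (ℕ)
open import Data.Fin using (Fin) renaming (_≤_ to _≤ᶠ_; _<_ to _<ᶠ_)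
open import Data.Product using (_×_; _,_)
open import Data.Sum using (_⊎_)
open import Relation.Binary.PropositionalEquality using (_≡_)

-- An m × n array over the alphabet {0,…,σ-1}; rows/columns are 0-indexed
-- (row 0 is the top row, column 0 the leftmost column).
Array : ℕ → ℕ → ℕ → Set
Array m n σ = Fin m → Fin n → Fin σ

Pos : ℕ → ℕ → Set
Pos m n = Fin m × Fin n

-- A 3-sided query [1,i] × [j1,j2] (0-indexed: rows 0..row, columns lo..hi, lo ≤ hi).
record Query (m n : ℕ) : Set where
  constructor query
  field
    row   : Fin m
    lo    : Fin n
    hi    : Fin n
    lo≤hi : lo ≤ᶠ hi
open Query public

InRect : ∀ {m n} → Query m n → Pos m n → Set
InRect q (r , c) = (r ≤ᶠ row q) × (lo q ≤ᶠ c) × (c ≤ᶠ hi q)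

LexLE : ∀ {m n} → Pos m n → Pos m n → Set
LexLE (r , c) (r' , c') = (r <ᶠ r') ⊎ ((r ≡ r') × (c ≤ᶠ c'))

entry : ∀ {m n σ} → Array m n σ → Pos m n → Fin σ
entry A (r , c) = A r c

IsRMQ : ∀ {m n σ} → Array m n σ → Query m n → Pos m n → Set
IsRMQ A q p =
  InRect q p
  × (∀ p' → InRect q p' → entry A p ≤ᶠ entry A p')
  × (∀ p' → InRect q p' → entry A p' ≡ entry A p → LexLE p p')

{-# OPTIONS --safe #-}
-- Fill each of the n columns independently with a "staircase": top entry σ - 1, then
-- at every row either the same value or one less, reaching 0 by the last row. Such a
-- column is fixed by the σ - 1 rows (out of m - 1) where it drops, giving
-- ((m-1) C (σ-1))^n arrays. Two different staircases first differ at a row i where one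
-- drops and the other does not; the 3-sided query rows 0..i of that single column then
-- has answer row i in the first array but a row above i in the second.

module Submission where

open import Defs
open import Data.Nat using (ℕ; zero; suc; _≤_; _<_; _∸_; _^_; z≤n; s≤s; _<?_)
open import Data.Nat.Properties
  using (≤-refl; ≤-trans; <-≤-trans; ≤-<-trans; <⇒≤; <⇒≱; <-irrefl; ≮⇒≥; n≤1+n; m≤n⇒m<n∨m≡n)
open import Data.Nat.Combinatorics using (_C_; nCk+nC[k+1]≡[n+1]C[k+1])
open import Data.Fin using (Fin; toℕ; fromℕ<; splitAt; join; cast; finToFun; funToFin; combine)
import Data.Fin.Properties as Fin
open import Data.Product using (Σ; ∃-syntax; _×_; _,_; proj₁)
open import Data.Sum using (_⊎_; inj₁; inj₂; [_,_]′)
open import Function using (_∘_)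
open import Relation.Binary.Definitions using (tri<; tri≈; tri>)
open import Relation.Nullary using (yes; no; contradiction)
open import Relation.Binary.PropositionalEquality
  using (_≡_; _≢_; _≗_; refl; sym; cong; cong₂; subst; subst₂; module ≡-Reasoning)

IsTopmostMin : (ℕ → ℕ) → ℕ → ℕ → Set
IsTopmostMin g k r = r ≤ k × (∀ r′ → r′ ≤ k → g r ≤ g r′) × (∀ r′ → r′ < r → g r < g r′)

topmostMin : (g : ℕ → ℕ) (k : ℕ) → Σ ℕ (IsTopmostMin g k)
topmostMin g zero = 0 , z≤n , (λ { _ z≤n → ≤-refl }) , (λ _ ())
topmostMin g (suc k) with topmostMin g k
... | r , r≤k , min , top with g (suc k) <? g r
... | yes below = suc k , ≤-refl , min′ , λ { r′ (s≤s r′≤k) → <-≤-trans below (min r′ r′≤k) }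
  where
  min′ : ∀ r′ → r′ ≤ suc k → g (suc k) ≤ g r′
  min′ r′ r′≤1+k with m≤n⇒m<n∨m≡n r′≤1+k
  ... | inj₁ (s≤s r′≤k) = ≤-trans (<⇒≤ below) (min r′ r′≤k)
  ... | inj₂ refl = ≤-refl
... | no ¬below = r , ≤-trans r≤k (n≤1+n k) , min′ , top
  where
  min′ : ∀ r′ → r′ ≤ suc k → g r ≤ g r′
  min′ r′ r′≤1+k with m≤n⇒m<n∨m≡n r′≤1+k
  ... | inj₁ (s≤s r′≤k) = min r′ r′≤k
  ... | inj₂ refl = ≮⇒≥ ¬below

topmostMinRow : ∀ {m} (g : ℕ → ℕ) (i : Fin m) → Σ (Fin m) λ R → IsTopmostMin g (toℕ i) (toℕ R)
topmostMinRow g i with topmostMin g (toℕ i)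
... | r , isMin@(r≤i , _) =
  fromℕ< (≤-<-trans r≤i (Fin.toℕ<n i)) ,
  subst (IsTopmostMin g (toℕ i)) (sym (Fin.toℕ-fromℕ< _)) isMin

columnQuery : ∀ {m n} → Fin m → Fin n → Query m n
columnQuery i j = query i j j Fin.≤-refl

topmostMin⇒IsRMQ : ∀ {m n σ} (A : Array m n σ) {g : ℕ → ℕ} (j : Fin n) →
  (∀ r → toℕ (A r j) ≡ g (toℕ r)) → ∀ {i R} → IsTopmostMin g (toℕ i) (toℕ R) →
  IsRMQ A (columnQuery i j) (R , j)
topmostMin⇒IsRMQ A {g} j A≗g {i} {R} (R≤i , min , top) =
  (R≤i , Fin.≤-refl , Fin.≤-refl) , minimal , topmost
  where
  minimal : ∀ p → InRect (columnQuery i j) p → toℕ (A R j) ≤ toℕ (entry A p)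
  minimal (r , c) (r≤i , j≤c , c≤j) with Fin.≤-antisym c≤j j≤c
  ... | refl = subst₂ _≤_ (sym (A≗g R)) (sym (A≗g r)) (min (toℕ r) r≤i)
  topmost : ∀ p → InRect (columnQuery i j) p → entry A p ≡ entry A (R , j) → LexLE (R , j) p
  topmost (r , c) (_ , j≤c , c≤j) tie with Fin.≤-antisym c≤j j≤c | Fin.<-cmp R r
  ... | refl | tri< R<r _ _ = inj₁ R<r
  ... | refl | tri≈ _ R≡r _ = inj₂ (R≡r , Fin.≤-refl)
  ... | refl | tri> _ _ r<R = contradiction (top (toℕ r) r<R) (<-irrefl gR≡gr)
    where
    open ≡-Reasoning
    gR≡gr : g (toℕ R) ≡ g (toℕ r)
    gR≡gr = begin
      g (toℕ R)    ≡⟨ A≗g R ⟨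
      toℕ (A R j)  ≡⟨ cong toℕ tie ⟨
      toℕ (A r j)  ≡⟨ A≗g r ⟩
      g (toℕ r)    ∎

Separates : (ℕ → ℕ) → (ℕ → ℕ) → ℕ → Set
Separates v w i = (∀ r → r < i → v i < v r) × (∃[ r ] r < i × w r ≡ w i)

separates⇒topmostMins-differ : ∀ {v w i ra rb} → Separates v w i →
  IsTopmostMin v i ra → IsTopmostMin w i rb → ra ≢ rb
separates⇒topmostMins-differ (drop , r , r<i , repeat) (ra≤i , minA , _) (_ , _ , topB) refl
  with m≤n⇒m<n∨m≡n ra≤i
... | inj₁ ra<i = <⇒≱ (drop _ ra<i) (minA _ ≤-refl)
... | inj₂ refl = <-irrefl (sym repeat) (topB r r<i)

Distinguishable : ℕ → (ℕ → ℕ) → (ℕ → ℕ) → Set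
Distinguishable m v w = Σ (Fin m) λ i → Separates v w (toℕ i) ⊎ Separates w v (toℕ i)

distinguishable⇒answers-differ : ∀ {m n σ} (A B : Array m n σ) (j : Fin n) {v w : ℕ → ℕ} →
  (∀ r → toℕ (A r j) ≡ v (toℕ r)) → (∀ r → toℕ (B r j) ≡ w (toℕ r)) → Distinguishable m v w →
  Σ (Query m n) λ q → Σ (Pos m n) λ p → Σ (Pos m n) λ p′ →
    IsRMQ A q p × IsRMQ B q p′ × p ≢ p′
distinguishable⇒answers-differ A B j {v} {w} A≗v B≗w (i , separated)
  with topmostMinRow v i | topmostMinRow w i
... | Ra , minA | Rb , minB =
  columnQuery i j , (Ra , j) , (Rb , j) ,
  topmostMin⇒IsRMQ A j A≗v minA , topmostMin⇒IsRMQ B j B≗w minB ,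
  rows-differ separated ∘ cong (toℕ ∘ proj₁)
  where
  rows-differ : Separates v w (toℕ i) ⊎ Separates w v (toℕ i) → toℕ Ra ≢ toℕ Rb
  rows-differ (inj₁ sep) = separates⇒topmostMins-differ sep minA minB
  rows-differ (inj₂ sep) = separates⇒topmostMins-differ sep minB minA ∘ sym

infixr 5 _∷_
_∷_ : ℕ → (ℕ → ℕ) → ℕ → ℕ
(h ∷ t) zero = h
(h ∷ t) (suc r) = t r

separates-∷ : ∀ {v w i h} → Separates v w i → v 0 ≤ h → Separates (h ∷ v) (h ∷ w) (suc i)
separates-∷ {v} {i = i} {h} (drop , r , r<i , repeat) v₀≤h = drop′ , suc r , s≤s r<i , repeat
  where
  drop′ : ∀ r′ → r′ < suc i → v i < (h ∷ v) r′
  drop′ zero _ = <-≤-trans (drop 0 (≤-<-trans z≤n r<i)) v₀≤h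
  drop′ (suc r′) (s≤s r′<i) = drop r′ r′<i

separates-at-1 : ∀ {v w h} → v 0 < h → w 0 ≡ h → Separates (h ∷ v) (h ∷ w) 1
separates-at-1 v₀<h w₀≡h = (λ { zero _ → v₀<h ; (suc _) (s≤s ()) }) , 0 , s≤s z≤n , sym w₀≡h

distinguishable-∷ : ∀ {m v w h} → Distinguishable m v w → v 0 ≤ h → w 0 ≤ h →
  Distinguishable (suc m) (h ∷ v) (h ∷ w)
distinguishable-∷ (i , inj₁ sep) v₀≤h _ = Fin.suc i , inj₁ (separates-∷ sep v₀≤h)
distinguishable-∷ (i , inj₂ sep) _ w₀≤h = Fin.suc i , inj₂ (separates-∷ sep w₀≤h)

pascal-split : ∀ k s → Fin (suc k C suc s) → Fin (k C s) ⊎ Fin (k C suc s)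
pascal-split k s = splitAt (k C s) ∘ cast (sym (nCk+nC[k+1]≡[n+1]C[k+1] k s))

pascal-split-injective : ∀ k s {c c′} → pascal-split k s c ≡ pascal-split k s c′ → c ≡ c′
pascal-split-injective k s {c} {c′} eq = Fin.toℕ-injective (begin
  toℕ c                                 ≡⟨ Fin.toℕ-cast _ c ⟨
  toℕ (cast _ c)                        ≡⟨ cong toℕ (Fin.join-splitAt (k C s) _ (cast _ c)) ⟨
  toℕ (join _ _ (pascal-split k s c))   ≡⟨ cong (toℕ ∘ join (k C s) _) eq ⟩
  toℕ (join _ _ (pascal-split k s c′))  ≡⟨ cong toℕ (Fin.join-splitAt (k C s) _ (cast _ c′)) ⟩
  toℕ (cast _ c′)                       ≡⟨ Fin.toℕ-cast _ c′ ⟩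
  toℕ c′                                ∎)
  where open ≡-Reasoning

-- The columns of k + 1 rows that start at s, end at 0 and drop by 0 or 1 from
-- each row to the next; choosing the s rows where a drop happens gives k C s of them,
-- enumerated along Pascal's rule by whether the drop at row 1 happens.
staircase : ∀ k s → Fin (k C s) → ℕ → ℕ
staircase k zero _ _ = 0
staircase zero (suc s) ()
staircase (suc k) (suc s) c = suc s ∷ [ staircase k s , staircase k (suc s) ]′ (pascal-split k s c)

staircase-head : ∀ k s c → staircase k s c 0 ≡ s
staircase-head k zero c = refl
staircase-head zero (suc s) ()
staircase-head (suc k) (suc s) c = refl

staircase-≤ : ∀ k s c r → staircase k s c r ≤ s
staircase-≤ k zero c r = z≤n
staircase-≤ zero (suc s) ()
staircase-≤ (suc k) (suc s) c zero = ≤-refl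
staircase-≤ (suc k) (suc s) c (suc r) with pascal-split k s c
... | inj₁ x = ≤-trans (staircase-≤ k s x r) (n≤1+n s)
... | inj₂ y = staircase-≤ k (suc s) y r

staircase-distinguishable : ∀ k s {c c′} → c ≢ c′ →
  Distinguishable (suc k) (staircase k s c) (staircase k s c′)
staircase-distinguishable k zero {Fin.zero} {Fin.zero} c≢c′ = contradiction refl c≢c′
staircase-distinguishable zero (suc s) {()}
staircase-distinguishable (suc k) (suc s) {c} {c′} c≢c′ =
  tails (pascal-split k s c) (pascal-split k s c′) (c≢c′ ∘ pascal-split-injective k s)
  where
  tail : Fin (k C s) ⊎ Fin (k C suc s) → ℕ → ℕ
  tail = [ staircase k s , staircase k (suc s) ]′
  tails : ∀ u u′ → u ≢ u′ → Distinguishable (suc (suc k)) (suc s ∷ tail u) (suc s ∷ tail u′)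
  tails (inj₁ x) (inj₁ x′) x≢x′ =
    distinguishable-∷ (staircase-distinguishable k s (x≢x′ ∘ cong inj₁))
      (≤-trans (staircase-≤ k s x 0) (n≤1+n s)) (≤-trans (staircase-≤ k s x′ 0) (n≤1+n s))
  tails (inj₂ y) (inj₂ y′) y≢y′ =
    distinguishable-∷ (staircase-distinguishable k (suc s) (y≢y′ ∘ cong inj₂))
      (staircase-≤ k (suc s) y 0) (staircase-≤ k (suc s) y′ 0)
  tails (inj₁ x) (inj₂ y) _ =
    Fin.suc Fin.zero , inj₁ (separates-at-1 (s≤s (staircase-≤ k s x 0)) (staircase-head k (suc s) y))
  tails (inj₂ y) (inj₁ x) _ =
    Fin.suc Fin.zero , inj₂ (separates-at-1 (s≤s (staircase-≤ k s x 0)) (staircase-head k (suc s) y))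

funToFin-cong : ∀ {n K} {f g : Fin n → Fin K} → f ≗ g → funToFin f ≡ funToFin g
funToFin-cong {zero} _ = refl
funToFin-cong {suc n} f≗g = cong₂ combine (f≗g Fin.zero) (funToFin-cong (f≗g ∘ Fin.suc))

finToFun-injective : ∀ {K n} {a b : Fin (K ^ n)} → finToFun {K} {n} a ≗ finToFun b → a ≡ b
finToFun-injective {K} {n} {a} {b} a≗b = begin
  a                                ≡⟨ Fin.funToFin-finToFin {n} {K} a ⟨
  funToFin (finToFun {K} {n} a)    ≡⟨ funToFin-cong a≗b ⟩
  funToFin (finToFun {K} {n} b)    ≡⟨ Fin.funToFin-finToFin {n} {K} b ⟩
  b                                ∎
  where open ≡-Reasoning

finToFun-distinct : ∀ {K n} {a b : Fin (K ^ n)} → a ≢ b →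
  ∃[ j ] finToFun {K} {n} a j ≢ finToFun b j
finToFun-distinct {K} {n} {a} {b} a≢b =
  Fin.¬∀⟶∃¬ n _ (λ j → finToFun {K} a j Fin.≟ finToFun b j) (a≢b ∘ finToFun-injective)

-- The hypotheses m ≤ n and σ < m only matter for the asymptotic form of the bound.
theorem15 : (m n σ : ℕ) → m ≤ n → 1 ≤ σ → σ < m →
    Σ (Fin (((m ∸ 1) C (σ ∸ 1)) ^ n) → Array m n σ) λ f →
    (a b : Fin (((m ∸ 1) C (σ ∸ 1)) ^ n)) → a ≢ b →
    Σ (Query m n) λ q → Σ (Pos m n) λ p → Σ (Pos m n) λ p' →
    IsRMQ (f a) q p × IsRMQ (f b) q p' × p ≢ p'
theorem15 zero n σ _ _ ()
theorem15 (suc m) n zero _ () _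
theorem15 (suc m) n (suc s) _ _ _ = array , λ a b a≢b →
  let j , columns-differ = finToFun-distinct {m C s} {n} a≢b
  in distinguishable⇒answers-differ (array a) (array b) j
       (λ _ → Fin.toℕ-fromℕ< _) (λ _ → Fin.toℕ-fromℕ< _)
       (staircase-distinguishable m s columns-differ)
  where
  array : Fin ((m C s) ^ n) → Array (suc m) n (suc s)
  array a r j = fromℕ< (s≤s (staircase-≤ m s (finToFun {m C s} {n} a j) (toℕ r)))
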